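{- Let $m>1$ be an integer and let $(a,b,c)$ be an ordered $m$-Markoff triple. Then: 1. $(a,b,c)$ is minimal if and only if $a^2+b^2\le m$. 2. If $(a,b,c)$ is minimal, then $1\le a\le \sqrt{m/2}$. 3. If $(a,b,c)$ is minimal, then $c>\sqrt{m}$, and if moreover $c\ne 3ab$, then $c<m$. 4. If $(a,b,c)$ is minimal, then $3ab\le c\le 3ab+\sqrt{m-a^2-b^2}$.
   Context: An $m$-Markoff triple is a triple $(a,b,c)$ of positive integers with $a^2+b^2+c^2=3abc+m$; it is ordered if $a\le b\le c$. A minimal triple is an ordered $m$-Markoff triple $(a,b,c)$ with $3ab-c\le 0$. -}

module Defs where

open import Data.Nat using (ℕ; _+_; _*_; _^_; _≤_; _<_)
open import Data.Product using (_×_)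
open import Relation.Binary.PropositionalEquality using (_≡_)

MarkoffTriple : ℕ → ℕ → ℕ → ℕ → Set
MarkoffTriple m a b c =
  (1 ≤ a) × (1 ≤ b) × (1 ≤ c) × (a ^ 2 + b ^ 2 + c ^ 2 ≡ 3 * a * b * c + m)

OrderedMarkoffTriple : ℕ → ℕ → ℕ → ℕ → Set
OrderedMarkoffTriple m a b c = MarkoffTriple m a b c × (a ≤ b) × (b ≤ c)

-- minimal: ordered and 3ab - c ≤ 0 (over ℤ), i.e. 3ab ≤ c
Minimal : ℕ → ℕ → ℕ → ℕ → Set
Minimal m a b c = OrderedMarkoffTriple m a b c × (3 * a * b ≤ c)

{-# OPTIONS --safe #-}
module Submission where

-- Put A = a² + b² and x = 3ab, so that the Markoff equation reads A + c² = x c + m, a quadratic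
-- in c. If c = x + d it becomes m = A + c d, and if x = c + k it becomes A = k c + m; hence
-- 3ab ≤ c exactly when A ≤ m (for c ≥ 1). On a minimal triple m − A = c d with d = c − 3ab ≤ c,
-- which gives the bounds on c, while A < x c (for a ≤ b ≤ c) forces c² > m.

open import Defs
open import Data.Nat using (ℕ; _+_; _*_; _^_; _∸_; _≤_; _<_)
open import Data.Nat.Properties
open import Data.Nat.Tactic.RingSolver using (solve-∀)
open import Data.Product using (_×_; _,_)
open import Function using (_∘′_)
open import Function.Bundles using (_⇔_; mk⇔; Equivalence)
open import Relation.Binary.PropositionalEquality
open import Relation.Nullary using (¬_)

open Equivalence using (to; from)

m≤n⇒m^2≤m*n : ∀ {u v} → u ≤ v → u ^ 2 ≤ u * v
m≤n⇒m^2≤m*n {u} {v} u≤v = subst (_≤ u * v) (cong (u *_) (sym (*-identityʳ u))) (*-monoʳ-≤ u u≤v)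

quadratic-excess : ∀ A x d m → A + (x + d) ^ 2 ≡ x * (x + d) + m → m ≡ A + (x + d) * d
quadratic-excess A x d m eq = +-cancelʳ-≡ (x * (x + d)) m (A + (x + d) * d) (begin
  m + x * (x + d)          ≡⟨ +-comm m _ ⟩
  x * (x + d) + m          ≡⟨ sym eq ⟩
  A + (x + d) ^ 2          ≡⟨ expand A x d ⟩
  A + (x + d) * d + x * (x + d) ∎)
  where
  open ≡-Reasoning
  -- n ^ 2 unfolds to n * (n * 1); the solver does not handle _^_ here.
  expand : ∀ A x d → A + (x + d) * ((x + d) * 1) ≡ A + (x + d) * d + x * (x + d)
  expand = solve-∀

quadratic-deficit : ∀ A c k m → A + c ^ 2 ≡ (c + k) * c + m → A ≡ k * c + m
quadratic-deficit A c k m eq = +-cancelʳ-≡ (c ^ 2) A (k * c + m) (trans eq (expand c k m))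
  where
  expand : ∀ c k m → (c + k) * c + m ≡ k * c + m + c * (c * 1)
  expand = solve-∀

module _ {A x c m : ℕ} (eq : A + c ^ 2 ≡ x * c + m) where

  m≡A+c*[c∸x] : x ≤ c → m ≡ A + c * (c ∸ x)
  m≡A+c*[c∸x] x≤c with c ∸ x | m+[n∸m]≡n x≤c
  ... | d | refl = quadratic-excess A x d m eq

  c<x⇒m<A : 1 ≤ c → c < x → m < A
  c<x⇒m<A 1≤c c<x = subst (m <_) (sym A≡) (+-monoˡ-≤ m (*-mono-≤ (m<n⇒0<n∸m c<x) 1≤c))
    where
    A≡ : A ≡ (x ∸ c) * c + m
    A≡ = quadratic-deficit A c (x ∸ c) m (subst (λ y → A + c ^ 2 ≡ y * c + m)
                                                 (sym (m+[n∸m]≡n (<⇒≤ c<x))) eq)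

  x≤c⇔A≤m : 1 ≤ c → x ≤ c ⇔ A ≤ m
  x≤c⇔A≤m 1≤c = mk⇔ (λ x≤c → subst (A ≤_) (sym (m≡A+c*[c∸x] x≤c)) (m≤m+n A _))
               (λ A≤m → ≮⇒≥ (λ c<x → <⇒≱ (c<x⇒m<A 1≤c c<x) A≤m))

  A<x*c⇒m<c^2 : A < x * c → m < c ^ 2
  A<x*c⇒m<c^2 A<xc = +-cancelˡ-< A m (c ^ 2) (subst (A + m <_) (sym eq) (+-monoˡ-< m A<xc))

  x≤c∧c≢x⇒c<m : 1 ≤ A → x ≤ c → c ≢ x → c < m
  x≤c∧c≢x⇒c<m 1≤A x≤c c≢x = subst (c <_) (sym (m≡A+c*[c∸x] x≤c)) (+-mono-≤ 1≤A c≤c*d)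
    where
    c≤c*d : c ≤ c * (c ∸ x)
    c≤c*d = subst (_≤ c * (c ∸ x)) (*-identityʳ c)
              (*-monoʳ-≤ c (m<n⇒0<n∸m (≤∧≢⇒< x≤c (c≢x ∘′ sym))))

  [c∸x]^2≤m∸A : x ≤ c → (c ∸ x) ^ 2 ≤ m ∸ A
  [c∸x]^2≤m∸A x≤c rewrite m≡A+c*[c∸x] x≤c | m+n∸m≡n A (c * (c ∸ x)) =
    subst ((c ∸ x) ^ 2 ≤_) (*-comm (c ∸ x) c) (m≤n⇒m^2≤m*n (m∸n≤m c x))

a^2+b^2<3abc : ∀ {a b c} → 1 ≤ a → a ≤ b → b ≤ c → a ^ 2 + b ^ 2 < 3 * a * b * c
a^2+b^2<3abc {a} {b} {c} 1≤a a≤b b≤c = begin-strict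
  a ^ 2 + b ^ 2       ≤⟨ +-mono-≤ (≤-trans (^-monoˡ-≤ 2 a≤b) (m≤n⇒m^2≤m*n b≤c)) (m≤n⇒m^2≤m*n b≤c) ⟩
  b * c + b * c       <⟨ m<m+n (b * c + b * c) (*-mono-≤ 1≤b (≤-trans 1≤b b≤c)) ⟩
  b * c + b * c + b * c ≡⟨ triple b c ⟩
  1 * (3 * b * c)     ≤⟨ *-monoˡ-≤ (3 * b * c) 1≤a ⟩
  a * (3 * b * c)     ≡⟨ reassociate a b c ⟩
  3 * a * b * c       ∎
  where
  open ≤-Reasoning
  1≤b : 1 ≤ b
  1≤b = ≤-trans 1≤a a≤b
  triple : ∀ b c → b * c + b * c + b * c ≡ 1 * (3 * b * c)
  triple = solve-∀
  reassociate : ∀ a b c → a * (3 * b * c) ≡ 3 * a * b * c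
  reassociate = solve-∀

lemma2p2 : (m a b c : ℕ) → 1 < m → OrderedMarkoffTriple m a b c →
    (Minimal m a b c ⇔ (a ^ 2 + b ^ 2 ≤ m))
    × (Minimal m a b c → (1 ≤ a) × (2 * a ^ 2 ≤ m))
    × (Minimal m a b c → (m < c ^ 2) × (¬ (c ≡ 3 * a * b) → c < m))
    × (Minimal m a b c → (3 * a * b ≤ c) × ((c ∸ 3 * a * b) ^ 2 ≤ m ∸ (a ^ 2 + b ^ 2)))
lemma2p2 m a b c _ ordered@((1≤a , _ , 1≤c , eq) , a≤b , b≤c) =
  minimal⇔ , (λ (_ , x≤c) → 1≤a , ≤-trans 2a²≤A (A≤m x≤c))
           , (λ (_ , x≤c) → A<x*c⇒m<c^2 {x = 3 * a * b} eq (a^2+b^2<3abc 1≤a a≤b b≤c)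
                          , x≤c∧c≢x⇒c<m eq 1≤A x≤c)
           , (λ (_ , x≤c) → x≤c , [c∸x]^2≤m∸A eq x≤c)
  where
  A≤m : 3 * a * b ≤ c → a ^ 2 + b ^ 2 ≤ m
  A≤m = to (x≤c⇔A≤m eq 1≤c)
  minimal⇔ : Minimal m a b c ⇔ (a ^ 2 + b ^ 2 ≤ m)
  minimal⇔ = mk⇔ (λ (_ , x≤c) → A≤m x≤c) (λ A≤m → ordered , from (x≤c⇔A≤m eq 1≤c) A≤m)
  2a²≤A : 2 * a ^ 2 ≤ a ^ 2 + b ^ 2
  2a²≤A = subst (_≤ a ^ 2 + b ^ 2) (cong (a ^ 2 +_) (sym (+-identityʳ (a ^ 2))))
            (+-monoʳ-≤ (a ^ 2) (^-monoˡ-≤ 2 a≤b))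
  1≤A : 1 ≤ a ^ 2 + b ^ 2
  1≤A = ≤-trans (^-monoˡ-≤ 2 1≤a) (m≤m+n (a ^ 2) (b ^ 2))
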